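{- For every 2-SAT formula $F$, \[ \{x : x\underset{D_F}{\rightsquigarrow}\overline x\}=\{x : L^+_F(x)\text{ is not strictly distinct}\}=\{x : L^+_F(x)\setminus\{x,\overline x\}\text{ is not strictly distinct}\}. \]
   Context: Variables $x_1,\dots,x_n$, literals $x_i,\overline x_i$. A 2-clause is $u\vee v$ with $u,v$ strictly distinct ($u\ne v$, $u\ne\overline v$); a 2-SAT formula is a conjunction of 2-clauses. The digraph $D_F$ has the $2n$ literals as vertices and an edge $x\to y$ iff $\overline x\vee y$ is a clause of $F$. $x\rightsquigarrow y$ means there is a directed path from $x$ to $y$ in $D_F$ (with $x\rightsquigarrow x$ always). $L^+_F(x)=\{y : x\underset{D_F}{\rightsquigarrow} y\}$. A set of literals is strictly distinct if its elements are pairwise strictly distinct. -}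

module Defs where

open import Data.Nat using (ℕ)
open import Data.Fin using (Fin)
open import Data.Bool using (Bool; not)
open import Data.Product using (_×_; _,_; proj₁; proj₂)
open import Data.Sum using (_⊎_)
open import Data.List using (List)
open import Data.List.Relation.Unary.All using (All)
open import Data.List.Membership.Propositional using (_∈_)
open import Relation.Binary.PropositionalEquality using (_≡_; _≢_)
open import Relation.Binary.Construct.Closure.ReflexiveTransitive using (Star)
open import Relation.Nullary using (¬_)

-- A literal over variables x_1..x_n: a variable together with a polarity
-- (true = positive literal x_i, false = negated literal x̄_i).
Literal : ℕ → Set
Literal n = Fin n × Bool

‾_ : ∀ {n} → Literal n → Literal n
‾ (i , b) = (i , not b)

StrictlyDistinct : ∀ {n} → Literal n → Literal n → Set
StrictlyDistinct u v = (u ≢ v) × (u ≢ ‾ v)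

-- A 2-clause u ∨ v (as an ordered pair; the clause u ∨ v is the same as v ∨ u)
Clause : ℕ → Set
Clause n = Literal n × Literal n

Formula : ℕ → Set
Formula n = List (Clause n)

Is2SAT : ∀ {n} → Formula n → Set
Is2SAT F = All (λ c → StrictlyDistinct (proj₁ c) (proj₂ c)) F

HasClause : ∀ {n} → Formula n → Literal n → Literal n → Set
HasClause F u v = ((u , v) ∈ F) ⊎ ((v , u) ∈ F)

Edge : ∀ {n} → Formula n → Literal n → Literal n → Set
Edge F x y = HasClause F (‾ x) y

Reach : ∀ {n} → Formula n → Literal n → Literal n → Set
Reach F = Star (Edge F)

LitSet : ℕ → Set₁
LitSet n = Literal n → Set

L⁺ : ∀ {n} → Formula n → Literal n → LitSet n
L⁺ F x y = Reach F x y

_∖⟨_⟩ : ∀ {n} → LitSet n → Literal n → LitSet n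
(S ∖⟨ x ⟩) y = S y × (y ≢ x) × (y ≢ ‾ x)

StrictlyDistinctSet : ∀ {n} → LitSet n → Set
StrictlyDistinctSet S = ∀ u v → S u → S v → u ≢ v → StrictlyDistinct u v

{-# OPTIONS --safe #-}
-- D_F is skew-symmetric: x ⇝ y gives ȳ ⇝ x̄. So if L⁺(x) contains
-- complementary literals u and ū, then x ⇝ ū and u ⇝ x̄ combine to x ⇝ x̄.
-- Conversely, a path x ⇝ x̄ is non-empty. Its first step goes to some y that
-- is strictly distinct from x, because clauses have strictly distinct
-- literals. By skew-symmetry ȳ is in L⁺(x) too, so the pair y, ȳ shows that
-- L⁺(x) ∖ {x, x̄} is not strictly distinct. Turning "not strictly distinct"
-- back into a path x ⇝ x̄ needs reachability to be decidable, which holds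
-- because D_F has finitely many edges.
module Submission where

open import Defs
open import Data.Nat using (ℕ)
open import Data.Product using (_×_)
open import Relation.Nullary using (¬_)
open import Function.Bundles using (_⇔_)

open import Data.Bool as Bool using (true; false)
open import Data.Empty using (⊥-elim)
open import Data.Fin as Fin using ()
open import Level using (0ℓ)
open import Data.List using (List; []; _∷_)
open import Data.List.Membership.Propositional using (_∈_)
open import Data.List.Relation.Unary.All as All using ()
open import Data.List.Relation.Unary.Any using (here; there)
open import Data.Product using (∃-syntax; _,_; proj₁; proj₂; map₁)
open import Data.Product.Properties using (≡-dec)
open import Data.Sum as Sum using (_⊎_; inj₁; inj₂; [_,_]; swap)
open import Function.Base using (id)
open import Function.Bundles using (mk⇔)
open import Relation.Binary.Core using (Rel)
open import Relation.Binary.Definitions using (Decidable; DecidableEquality)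
open import Relation.Binary.PropositionalEquality using (_≡_; _≢_; refl; sym; cong; subst)
open import Relation.Binary.Construct.Closure.ReflexiveTransitive
  using (Star; ε; _◅_; _◅◅_; gmap; reverse)
import Relation.Binary.Construct.Closure.ReflexiveTransitive as Star
open import Relation.Nullary.Decidable using (map′; _⊎-dec_; _×-dec_; decidable-stable)

module _ {A : Set} where

  Arc : List (A × A) → Rel A 0ℓ
  Arc E x y = (x , y) ∈ E

  star-first-step : ∀ {ℓ} {R : Rel A ℓ} {a b} → Star R a b → a ≢ b → ∃[ c ] R a c × Star R c b
  star-first-step ε         a≢a = ⊥-elim (a≢a refl)
  star-first-step (r ◅ rs) _   = _ , r , rs

  module _ {a b : A} {E : List (A × A)} where

    star-∷⁻ : ∀ {x y} → Star (Arc ((a , b) ∷ E)) x y →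
              Star (Arc E) x y ⊎ (Star (Arc E) x a × Star (Arc E) b y)
    star-∷⁻ ε                = inj₁ ε
    star-∷⁻ (here refl ◅ rs) = inj₂ (ε , [ id , proj₂ ] (star-∷⁻ rs))
    star-∷⁻ (there r ◅ rs)   = Sum.map (r ◅_) (map₁ (r ◅_)) (star-∷⁻ rs)

    star-∷⁺ : ∀ {x y} → Star (Arc E) x y ⊎ (Star (Arc E) x a × Star (Arc E) b y) →
              Star (Arc ((a , b) ∷ E)) x y
    star-∷⁺ (inj₁ x⇝y)         = Star.map there x⇝y
    star-∷⁺ (inj₂ (x⇝a , b⇝y)) = Star.map there x⇝a ◅◅ here refl ◅ Star.map there b⇝y

  star-arc? : DecidableEquality A → (E : List (A × A)) → Decidable (Star (Arc E))
  star-arc? _≟_ []            x y = map′ (λ { refl → ε }) (λ { ε → refl ; (() ◅ _) }) (x ≟ y)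
  star-arc? _≟_ ((a , b) ∷ E) x y = map′ star-∷⁺ star-∷⁻
    (star-arc? _≟_ E x y ⊎-dec (star-arc? _≟_ E x a ×-dec star-arc? _≟_ E b y))

module _ {n : ℕ} where

  _≟ˡ_ : DecidableEquality (Literal n)
  _≟ˡ_ = ≡-dec Fin._≟_ Bool._≟_

  ‾-involutive : (u : Literal n) → ‾ ‾ u ≡ u
  ‾-involutive (i , true)  = refl
  ‾-involutive (i , false) = refl

  u≢‾u : (u : Literal n) → u ≢ ‾ u
  u≢‾u (i , true)  ()
  u≢‾u (i , false) ()

  StrictlyDistinct-sym : {u v : Literal n} → StrictlyDistinct u v → StrictlyDistinct v u
  StrictlyDistinct-sym {v = v} (u≢v , u≢‾v) =
      (λ v≡u → u≢v (sym v≡u))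
    , (λ v≡‾u → u≢‾v (subst (_≡ ‾ v) (‾-involutive _) (cong ‾_ (sym v≡‾u))))

  StrictlyDistinct-‾ʳ : {u v : Literal n} → StrictlyDistinct u v → StrictlyDistinct u (‾ v)
  StrictlyDistinct-‾ʳ {v = v} (u≢v , u≢‾v) =
    u≢‾v , (λ u≡‾‾v → u≢v (subst (_ ≡_) (‾-involutive v) u≡‾‾v))

  StrictlyDistinct-‾ˡ : {u v : Literal n} → StrictlyDistinct u v → StrictlyDistinct (‾ u) v
  StrictlyDistinct-‾ˡ sd = StrictlyDistinct-sym (StrictlyDistinct-‾ʳ (StrictlyDistinct-sym sd))

  complementary-¬StrictlyDistinctSet : ∀ {S : LitSet n} {u} →
                                       S u → S (‾ u) → ¬ StrictlyDistinctSet S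
  complementary-¬StrictlyDistinctSet {u = u} u∈S ‾u∈S sd =
    proj₂ (sd u (‾ u) u∈S ‾u∈S (u≢‾u u)) (sym (‾-involutive u))

  StrictlyDistinctSet-anti-mono : {S T : LitSet n} → (∀ {u} → S u → T u) →
                                  StrictlyDistinctSet T → StrictlyDistinctSet S
  StrictlyDistinctSet-anti-mono S⊆T sd u v u∈S v∈S = sd u v (S⊆T u∈S) (S⊆T v∈S)

  arcs : Formula n → List (Literal n × Literal n)
  arcs []            = []
  arcs ((u , v) ∷ F) = (‾ u , v) ∷ (‾ v , u) ∷ arcs F

  edge⇒arc : ∀ F {x y} → Edge F x y → Arc (arcs F) x y
  edge⇒arc ((_ , _) ∷ F) {x} (inj₁ (here refl)) = here (cong (_, _) (sym (‾-involutive x)))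
  edge⇒arc ((_ , _) ∷ F) {x} (inj₂ (here refl)) = there (here (cong (_, _) (sym (‾-involutive x))))
  edge⇒arc (_ ∷ F)            (inj₁ (there uv∈F)) = there (there (edge⇒arc F (inj₁ uv∈F)))
  edge⇒arc (_ ∷ F)            (inj₂ (there vu∈F)) = there (there (edge⇒arc F (inj₂ vu∈F)))

  arc⇒edge : ∀ F {x y} → Arc (arcs F) x y → Edge F x y
  arc⇒edge ((u , _) ∷ F) (here refl)         = inj₁ (here (cong (_, _) (‾-involutive u)))
  arc⇒edge ((_ , v) ∷ F) (there (here refl)) = inj₂ (here (cong (_ ,_) (‾-involutive v)))
  arc⇒edge (_ ∷ F)       (there (there a))   = Sum.map there there (arc⇒edge F a)

  reach? : (F : Formula n) → Decidable (Reach F)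
  reach? F x y =
    map′ (Star.map (arc⇒edge F)) (Star.map (edge⇒arc F)) (star-arc? _≟ˡ_ (arcs F) x y)

module _ {n : ℕ} (F : Formula n) where

  clause-strictly-distinct : Is2SAT F → ∀ {u v} → HasClause F u v → StrictlyDistinct u v
  clause-strictly-distinct is2SAT (inj₁ uv∈F) = All.lookup is2SAT uv∈F
  clause-strictly-distinct is2SAT (inj₂ vu∈F) = StrictlyDistinct-sym (All.lookup is2SAT vu∈F)

  edge-strictly-distinct : Is2SAT F → ∀ {x y} → Edge F x y → StrictlyDistinct y x
  edge-strictly-distinct is2SAT {x} x→y =
    subst (StrictlyDistinct _) (‾-involutive x)
      (StrictlyDistinct-‾ʳ (StrictlyDistinct-sym (clause-strictly-distinct is2SAT x→y)))

  edge-contrapose : ∀ {x y} → Edge F x y → Edge F (‾ y) (‾ x)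
  edge-contrapose {y = y} x→y = subst (λ w → HasClause F w _) (sym (‾-involutive y)) (swap x→y)

  reach-contrapose : ∀ {x y} → Reach F x y → Reach F (‾ y) (‾ x)
  reach-contrapose x⇝y = gmap ‾_ id (reverse edge-contrapose x⇝y)

  reach-complement : ∀ {x y} → Reach F x (‾ y) → Reach F y (‾ x)
  reach-complement {y = y} x⇝‾y = subst (λ w → Reach F w _) (‾-involutive y) (reach-contrapose x⇝‾y)

  ¬reach-‾⇒StrictlyDistinctSet-L⁺ : ∀ {x} → ¬ Reach F x (‾ x) → StrictlyDistinctSet (L⁺ F x)
  ¬reach-‾⇒StrictlyDistinctSet-L⁺ ¬x⇝‾x u v x⇝u x⇝v u≢v =
    u≢v , λ u≡‾v → ¬x⇝‾x (x⇝v ◅◅ reach-complement (subst (Reach F _) u≡‾v x⇝u))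

  reach-‾⇒¬StrictlyDistinctSet-L⁺ : ∀ {x} → Reach F x (‾ x) → ¬ StrictlyDistinctSet (L⁺ F x)
  reach-‾⇒¬StrictlyDistinctSet-L⁺ x⇝‾x = complementary-¬StrictlyDistinctSet ε x⇝‾x

  ¬StrictlyDistinctSet-L⁺⇒reach-‾ : ∀ {x} → ¬ StrictlyDistinctSet (L⁺ F x) → Reach F x (‾ x)
  ¬StrictlyDistinctSet-L⁺⇒reach-‾ {x} ¬sd =
    decidable-stable (reach? F x (‾ x)) (λ ¬x⇝‾x → ¬sd (¬reach-‾⇒StrictlyDistinctSet-L⁺ ¬x⇝‾x))

  reach-‾⇒¬StrictlyDistinctSet-L⁺∖ : Is2SAT F → ∀ {x} → Reach F x (‾ x) →
                                     ¬ StrictlyDistinctSet (L⁺ F x ∖⟨ x ⟩)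
  reach-‾⇒¬StrictlyDistinctSet-L⁺∖ is2SAT {x} x⇝‾x with star-first-step x⇝‾x (u≢‾u x)
  ... | y , x→y , y⇝‾x =
    complementary-¬StrictlyDistinctSet
      (x→y ◅ ε , y∉⟨x⟩) (reach-complement y⇝‾x , StrictlyDistinct-‾ˡ y∉⟨x⟩)
    where
    y∉⟨x⟩ : StrictlyDistinct y x
    y∉⟨x⟩ = edge-strictly-distinct is2SAT x→y

lemma2p4 : ∀ {n} (F : Formula n) → Is2SAT F → ∀ (x : Literal n) →
    (Reach F x (‾ x) ⇔ (¬ StrictlyDistinctSet (L⁺ F x)))
    × ((¬ StrictlyDistinctSet (L⁺ F x)) ⇔ (¬ StrictlyDistinctSet (L⁺ F x ∖⟨ x ⟩)))
lemma2p4 F is2SAT x =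
    mk⇔ (reach-‾⇒¬StrictlyDistinctSet-L⁺ F) (¬StrictlyDistinctSet-L⁺⇒reach-‾ F)
  , mk⇔ (λ ¬sd → reach-‾⇒¬StrictlyDistinctSet-L⁺∖ F is2SAT (¬StrictlyDistinctSet-L⁺⇒reach-‾ F ¬sd))
        (λ ¬sd∖ sd → ¬sd∖ (StrictlyDistinctSet-anti-mono proj₁ sd))
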